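{- Fix a field $\mathbb{F}$. Let $n,k$ be natural numbers with $k\in[n]$ and let $\mathbf{a}\in\{0,1\}^n_k$ be arbitrary. Then $\mathrm{ec}_{n,k}(\{0,1\}^n_k\setminus\{\mathbf{a}\})=\min\{k,n-k\}$.
   Context: $\{0,1\}^n_k\subseteq\mathbb{F}^n$ is the set of $0/1$ vectors of Hamming weight exactly $k$. A hyperplane is a set $\{\mathbf{x}\in\mathbb{F}^n:\ell(\mathbf{x})=0\}$ for a polynomial $\ell$ over $\mathbb{F}$ of degree exactly $1$. For $S\subseteq\{0,1\}^n_k$, $\mathrm{ec}_{n,k}(S)$ is the minimum number of hyperplanes in $\mathbb{F}^n$ whose union intersects $\{0,1\}^n_k$ exactly in $S$. -}

module Defs where

open import Level using (Level; _⊔_; suc)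
open import Algebra.Bundles using (CommutativeRing)
open import Data.Nat using (ℕ)
open import Data.Bool using (Bool; true; false)
open import Data.Fin using (Fin)
open import Data.Vec using (Vec; lookup; count)
open import Data.List using (List)
open import Data.List.Relation.Unary.Any using (Any)
open import Data.Product using (Σ; ∃; _×_; _,_)
open import Relation.Nullary using (¬_)
open import Relation.Binary.PropositionalEquality using (_≡_)
open import Function.Bundles using (_⇔_)
import Data.Bool.Properties as BoolP

record Field (c ℓ : Level) : Set (Level.suc (c ⊔ ℓ)) where
  field
    commutativeRing : CommutativeRing c ℓ
  open CommutativeRing commutativeRing public
  field
    0≉1     : ¬ (0# ≈ 1#)
    inverse : ∀ x → ¬ (x ≈ 0#) → Σ Carrier λ y → (x * y) ≈ 1#

weight : ∀ {n} → Vec Bool n → ℕ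
weight = count (BoolP._≟ true)

InSlice : ∀ {n} → ℕ → Vec Bool n → Set
InSlice k v = weight v ≡ k

module _ {c ℓ : Level} (F : Field c ℓ) where
  open Field F

  embed : ∀ {n} → Vec Bool n → Fin n → Carrier
  embed v i with lookup v i
  ... | true  = 1#
  ... | false = 0#

  Σᶠ : ∀ {n} → (Fin n → Carrier) → Carrier
  Σᶠ {ℕ.zero}  f = 0#
  Σᶠ {ℕ.suc n} f = f Fin.zero + Σᶠ (λ i → f (Fin.suc i))

  record Hyperplane (n : ℕ) : Set (c ⊔ ℓ) where
    field
      const   : Carrier
      coeff   : Fin n → Carrier
      nonzero : ∃ λ i → ¬ (coeff i ≈ 0#)

  evalH : ∀ {n} → Hyperplane n → (Fin n → Carrier) → Carrier
  evalH H x = Hyperplane.const H + Σᶠ (λ i → Hyperplane.coeff H i * x i)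

  _∈H_ : ∀ {n} → (Fin n → Carrier) → Hyperplane n → Set ℓ
  x ∈H H = evalH H x ≈ 0#

  ExactCover : ∀ {n} (k : ℕ) (S : Vec Bool n → Set) → List (Hyperplane n) → Set (c ⊔ ℓ)
  ExactCover k S hs = ∀ v → InSlice k v → (Any (λ H → embed v ∈H H) hs ⇔ S v)

  ECEquals : ∀ (n k : ℕ) (S : Vec Bool n → Set) → ℕ → Set (c ⊔ ℓ)
  ECEquals n k S m =
    (Σ (List (Hyperplane n)) λ hs → (Data.List.length hs ≡ m) × ExactCover k S hs)
    × (∀ (hs : List (Hyperplane n)) → ExactCover k S hs → m Data.Nat.≤ Data.List.length hs)

module Submission where

-- Upper bound: when k ≤ n - k, the k hyperplanes xᵢ = 0 with aᵢ = 1 meet the slice exactly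
-- outside a, since a weight-k vector other than a must turn some 1 of a into a 0; otherwise
-- the n - k hyperplanes xⱼ = 1 with aⱼ = 0 do the same.
--
-- Lower bound (polynomial method): pair m = min(k, n - k) ones iₜ of a with distinct zeros jₜ
-- and let Δₜ f v = f(v with iₜ := 0, jₜ := 1) - f(v with iₜ := 1, jₜ := 0). On the cube each
-- Δₜ lowers the degree of a polynomial by one, so Δ₁ ⋯ Δₘ annihilates every product of fewer
-- than m affine functions. If hyperplanes cover the slice minus a, the product f of their
-- equations vanishes at all points other than a at which Δ₁ ⋯ Δₘ f a evaluates f (they lie in
-- the slice), while f a ≠ 0; so Δ₁ ⋯ Δₘ f a = ± f a ≠ 0, and at least m hyperplanes are needed.

open import Defs
open import Level using (Level; _⊔_)
open import Data.Nat as ℕ using (ℕ; zero; suc; _≤_; _⊓_; _∸_; s≤s)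
open import Data.Nat.Properties using (≤-trans; n≤1+n; <-irrefl; ≤-reflexive; +-∸-assoc; ≮⇒≥; ⊓-sel)
open import Data.Bool using (Bool; true; false; not)
open import Data.Bool.Properties using (_≟_; not-¬)
open import Data.Fin as Fin using (Fin; zero; suc)
open import Data.Fin.Properties using (suc-injective)
open import Data.Vec using (Vec; []; _∷_; lookup; _[_]≔_)
open import Data.Vec.Properties using (lookup∘update; lookup∘update′; []≔-lookup; []≔-idempotent; []≔-commutes; count≤n)
open import Data.List using (List; []; _∷_; length; map; zip)
open import Data.List.Properties using (length-map; length-zipWith)
open import Data.List.Membership.Propositional using (_∈_; find; lose)
open import Data.List.Membership.Propositional.Properties using (∈-map⁺; ∈-map⁻)
open import Data.List.Relation.Unary.All as All using (All; []; _∷_)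
import Data.List.Relation.Unary.All.Properties as All
open import Data.List.Relation.Unary.AllPairs using ([]; _∷_)
open import Data.List.Relation.Unary.Any using (Any; here; there)
import Data.List.Relation.Unary.Any.Properties as Any
open import Data.List.Relation.Unary.Unique.Propositional using (Unique)
import Data.List.Relation.Unary.Unique.Propositional.Properties as Unique
open import Data.Product using (Σ; ∃; _×_; _,_; proj₁; proj₂)
open import Data.Sum using (inj₁; inj₂)
open import Data.Empty using (⊥-elim)
open import Function using (_∘_)
open import Function.Bundles using (Equivalence; mk⇔)
open import Relation.Nullary using (¬_; yes; no)
open import Relation.Binary.PropositionalEquality
  using (_≡_; _≢_; refl; sym; trans; cong; cong₂; subst; ≢-sym; module ≡-Reasoning)

weight-[]≔false : ∀ {n} (v : Vec Bool n) i → lookup v i ≡ true →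
                  suc (weight (v [ i ]≔ false)) ≡ weight v
weight-[]≔false (true  ∷ v) zero    refl = refl
weight-[]≔false (true  ∷ v) (suc i) p    = cong suc (weight-[]≔false v i p)
weight-[]≔false (false ∷ v) (suc i) p    = weight-[]≔false v i p

weight-[]≔true : ∀ {n} (v : Vec Bool n) i → lookup v i ≡ false →
                 weight (v [ i ]≔ true) ≡ suc (weight v)
weight-[]≔true (false ∷ v) zero    refl = refl
weight-[]≔true (true  ∷ v) (suc i) p    = cong suc (weight-[]≔true v i p)
weight-[]≔true (false ∷ v) (suc i) p    = weight-[]≔true v i p

lookup-true-false⇒≢ : ∀ {n} (v : Vec Bool n) {i j} →
                      lookup v i ≡ true → lookup v j ≡ false → i ≢ j
lookup-true-false⇒≢ v vi vj refl with trans (sym vi) vj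
... | ()

weight≤∧≢⇒lost-one : ∀ {n} (v a : Vec Bool n) → weight v ≤ weight a → v ≢ a →
                     ∃ λ i → lookup a i ≡ true × lookup v i ≡ false
weight≤∧≢⇒lost-one []          []          _        v≢a = ⊥-elim (v≢a refl)
weight≤∧≢⇒lost-one (false ∷ v) (true  ∷ a) _        _   = zero , refl , refl
weight≤∧≢⇒lost-one (true  ∷ v) (true  ∷ a) (s≤s le) v≢a =
  let i , ai , vi = weight≤∧≢⇒lost-one v a le (v≢a ∘ cong (true ∷_)) in suc i , ai , vi
weight≤∧≢⇒lost-one (false ∷ v) (false ∷ a) le       v≢a =
  let i , ai , vi = weight≤∧≢⇒lost-one v a le (v≢a ∘ cong (false ∷_)) in suc i , ai , vi
weight≤∧≢⇒lost-one (true  ∷ v) (false ∷ a) le       _   =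
  let i , ai , vi = weight≤∧≢⇒lost-one v a (≤-trans (n≤1+n _) le) (λ { refl → <-irrefl refl le })
  in suc i , ai , vi

weight≡∧≢⇒differ : ∀ {n} (v a : Vec Bool n) → weight v ≡ weight a → v ≢ a →
                   ∀ b → ∃ λ i → lookup a i ≡ b × lookup v i ≡ not b
weight≡∧≢⇒differ v a eq v≢a true  = weight≤∧≢⇒lost-one v a (≤-reflexive eq) v≢a
weight≡∧≢⇒differ v a eq v≢a false =
  let i , vi , ai = weight≤∧≢⇒lost-one a v (≤-reflexive (sym eq)) (v≢a ∘ sym) in i , ai , vi

Pair : ℕ → Set
Pair n = Fin n × Fin n

assign : ∀ {n} → Pair n → Bool → Vec Bool n → Vec Bool n
assign (i , j) b v = (v [ i ]≔ b) [ j ]≔ not b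

assign-self : ∀ {n} (v : Vec Bool n) {i j b} → lookup v i ≡ b → lookup v j ≡ not b →
              assign (i , j) b v ≡ v
assign-self v {i} {j} {b} vi vj = begin
  (v [ i ]≔ b) [ j ]≔ not b                ≡⟨ cong₂ (λ x y → (v [ i ]≔ x) [ j ]≔ y) (sym vi) (sym vj) ⟩
  (v [ i ]≔ lookup v i) [ j ]≔ lookup v j  ≡⟨ cong (_[ j ]≔ lookup v j) ([]≔-lookup v i) ⟩
  v [ j ]≔ lookup v j                      ≡⟨ []≔-lookup v j ⟩
  v                                        ∎
  where open ≡-Reasoning

lookup-assign-fst : ∀ {n} (v : Vec Bool n) {i j} b → i ≢ j → lookup (assign (i , j) b v) i ≡ b
lookup-assign-fst v {i} b i≢j =
  trans (lookup∘update′ i≢j (v [ i ]≔ b) _) (lookup∘update i v b)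

lookup-assign-other : ∀ {n} (v : Vec Bool n) {i j x} b → x ≢ i → x ≢ j →
                      lookup (assign (i , j) b v) x ≡ lookup v x
lookup-assign-other v {i} b x≢i x≢j =
  trans (lookup∘update′ x≢j (v [ i ]≔ b) _) (lookup∘update′ x≢i v b)

weight-assign-false : ∀ {n} (v : Vec Bool n) {i j} → lookup v i ≡ true → lookup v j ≡ false →
                      weight (assign (i , j) false v) ≡ weight v
weight-assign-false v {i} {j} vi vj =
  trans (weight-[]≔true (v [ i ]≔ false) j
          (trans (lookup∘update′ (≢-sym (lookup-true-false⇒≢ v vi vj)) v false) vj))
        (weight-[]≔false v i vi)

positions : ∀ {n} → Bool → Vec Bool n → List (Fin n)
positions b []      = []
positions b (x ∷ v) with x ≟ b
... | yes _ = zero ∷ map suc (positions b v)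
... | no  _ = map suc (positions b v)

∈-positions⁺ : ∀ {n} (v : Vec Bool n) {i b} → lookup v i ≡ b → i ∈ positions b v
∈-positions⁺ (x ∷ v) {zero}  {b} x≡b with x ≟ b
... | yes _   = here refl
... | no  x≢b = ⊥-elim (x≢b x≡b)
∈-positions⁺ (x ∷ v) {suc i} {b} vi with x ≟ b
... | yes _ = there (∈-map⁺ suc (∈-positions⁺ v vi))
... | no  _ = ∈-map⁺ suc (∈-positions⁺ v vi)

∈-map-suc⁻ : ∀ {n} {i : Fin n} {xs} → suc i ∈ map suc xs → i ∈ xs
∈-map-suc⁻ p with ∈-map⁻ suc p
... | _ , q , refl = q

zero∉map-suc : ∀ {n} {xs : List (Fin n)} → ¬ Fin.zero ∈ map Fin.suc xs
zero∉map-suc p with ∈-map⁻ suc p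
... | _ , _ , ()

∈-positions⁻ : ∀ {n} (v : Vec Bool n) {i b} → i ∈ positions b v → lookup v i ≡ b
∈-positions⁻ (x ∷ v) {zero}  {b} p with x ≟ b | p
... | yes x≡b | _ = x≡b
... | no  _   | q = ⊥-elim (zero∉map-suc q)
∈-positions⁻ (x ∷ v) {suc i} {b} p with x ≟ b | p
... | yes _ | there q = ∈-positions⁻ v (∈-map-suc⁻ q)
... | no  _ | q       = ∈-positions⁻ v (∈-map-suc⁻ q)

positions-unique : ∀ {n} b (v : Vec Bool n) → Unique (positions b v)
positions-unique b []      = []
positions-unique b (x ∷ v) with x ≟ b
... | yes _ = All.map⁺ (All.universal (λ _ ()) _) ∷ Unique.map⁺ suc-injective (positions-unique b v)
... | no  _ = Unique.map⁺ suc-injective (positions-unique b v)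

length-positions-true : ∀ {n} (v : Vec Bool n) → length (positions true v) ≡ weight v
length-positions-true []          = refl
length-positions-true (true  ∷ v) =
  cong suc (trans (length-map Fin.suc (positions true v)) (length-positions-true v))
length-positions-true (false ∷ v) =
  trans (length-map Fin.suc (positions true v)) (length-positions-true v)

length-positions-false : ∀ {n} (v : Vec Bool n) → length (positions false v) ≡ n ∸ weight v
length-positions-false []          = refl
length-positions-false (true  ∷ v) =
  trans (length-map Fin.suc (positions false v)) (length-positions-false v)
length-positions-false (false ∷ v) =
  trans (cong suc (trans (length-map Fin.suc (positions false v)) (length-positions-false v)))
        (sym (+-∸-assoc 1 (count≤n _ v)))

Avoids : ∀ {n} → Fin n → Pair n → Set
Avoids x (i , j) = x ≢ i × x ≢ j

data Matching {n} (a : Vec Bool n) : List (Pair n) → Set where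
  []   : Matching a []
  cons : ∀ {i j P} → lookup a i ≡ true → lookup a j ≡ false →
         All (Avoids i) P → All (Avoids j) P → Matching a P → Matching a ((i , j) ∷ P)

zip-avoids : ∀ {n} {x : Fin n} {I J} → All (x ≢_) I → All (x ≢_) J → All (Avoids x) (zip I J)
zip-avoids []         _          = []
zip-avoids (_ ∷ _)    []         = []
zip-avoids (p ∷ ps)   (q ∷ qs)   = (p , q) ∷ zip-avoids ps qs

zip-matching : ∀ {n} (a : Vec Bool n) {I J} →
               All (λ i → lookup a i ≡ true) I → All (λ j → lookup a j ≡ false) J →
               Unique I → Unique J → Matching a (zip I J)
zip-matching a []         _          _          _          = []
zip-matching a (_ ∷ _)    []         _          _          = []
zip-matching a (ai ∷ aI)  (aj ∷ aJ)  (i∉I ∷ uI) (j∉J ∷ uJ) =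
  cons ai aj
    (zip-avoids i∉I (All.map (lookup-true-false⇒≢ a ai) aJ))
    (zip-avoids (All.map (λ ai′ → ≢-sym (lookup-true-false⇒≢ a ai′ aj)) aI) j∉J)
    (zip-matching a aI aJ uI uJ)

standardMatching : ∀ {n} → Vec Bool n → List (Pair n)
standardMatching a = zip (positions true a) (positions false a)

standardMatching-matching : ∀ {n} (a : Vec Bool n) → Matching a (standardMatching a)
standardMatching-matching a =
  zip-matching a (All.tabulate (∈-positions⁻ a)) (All.tabulate (∈-positions⁻ a))
    (positions-unique true a) (positions-unique false a)

length-standardMatching : ∀ {n} (a : Vec Bool n) →
                          length (standardMatching a) ≡ weight a ⊓ (n ∸ weight a)
length-standardMatching a =
  trans (length-zipWith _,_ (positions true a) (positions false a))
        (cong₂ _⊓_ (length-positions-true a) (length-positions-false a))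

-- The vectors obtained from a by transferring the one of some of the pairs of P to the zero:
-- these are the points at which Δ* P f a evaluates f.
data Reachable {n} (a : Vec Bool n) : List (Pair n) → Vec Bool n → Set where
  base     : ∀ {P} → Reachable a P a
  skip     : ∀ {p P v} → Reachable a P v → Reachable a (p ∷ P) v
  transfer : ∀ {p P v} → Reachable a P v → Reachable a (p ∷ P) (assign p false v)

lookup-reachable : ∀ {n} {a : Vec Bool n} {P v x} → All (Avoids x) P → Reachable a P v →
                   lookup v x ≡ lookup a x
lookup-reachable _                      base                 = refl
lookup-reachable (_ ∷ avoids)           (skip r)             = lookup-reachable avoids r
lookup-reachable ((x≢i , x≢j) ∷ avoids) (transfer {v = v} r) =
  trans (lookup-assign-other v false x≢i x≢j) (lookup-reachable avoids r)

weight-reachable : ∀ {n} {a : Vec Bool n} {P v} → Matching a P → Reachable a P v →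
                   weight v ≡ weight a
weight-reachable _                      base                 = refl
weight-reachable (cons _ _ _ _ m)       (skip r)             = weight-reachable m r
weight-reachable (cons ai aj avI avJ m) (transfer {v = v} r) =
  trans (weight-assign-false v (trans (lookup-reachable avI r) ai) (trans (lookup-reachable avJ r) aj))
        (weight-reachable m r)

module _ {c ℓ : Level} (F : Field c ℓ) where
  open Field F hiding (zero) renaming (refl to ≈-refl; sym to ≈-sym; trans to ≈-trans)
  open import Relation.Binary.Reasoning.Setoid setoid
  open import Algebra.Properties.Group +-group using (x∙y⁻¹≈ε⇒x≈y; x≈y⇒x∙y⁻¹≈ε)
  open import Algebra.Properties.AbelianGroup +-abelianGroup using (⁻¹-∙-comm)
  open import Algebra.Properties.CommutativeSemigroup +-commutativeSemigroup using (interchange)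
  open import Algebra.Properties.Ring ring using (x[y-z]≈xy-xz; [y-z]x≈yx-zx)

  [x+y]-[u+v]≈[x-u]+[y-v] : ∀ x y u v → (x + y) - (u + v) ≈ (x - u) + (y - v)
  [x+y]-[u+v]≈[x-u]+[y-v] x y u v = begin
    (x + y) + - (u + v)    ≈⟨ +-congˡ (⁻¹-∙-comm u v) ⟨
    (x + y) + (- u + - v)  ≈⟨ interchange x y (- u) (- v) ⟩
    (x - u) + (y - v)      ∎

  [w+x]-[w+y]≈x-y : ∀ w x y → (w + x) - (w + y) ≈ x - y
  [w+x]-[w+y]≈x-y w x y = begin
    (w + x) - (w + y)  ≈⟨ [x+y]-[u+v]≈[x-u]+[y-v] w x w y ⟩
    (w - w) + (x - y)  ≈⟨ +-congʳ (-‿inverseʳ w) ⟩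
    0# + (x - y)       ≈⟨ +-identityˡ (x - y) ⟩
    x - y              ∎

  [x-y]+[y-z]≈x-z : ∀ x y z → (x - y) + (y - z) ≈ x - z
  [x-y]+[y-z]≈x-z x y z = begin
    (x - y) + (y - z)  ≈⟨ [x+y]-[u+v]≈[x-u]+[y-v] x y y z ⟨
    (x + y) - (y + z)  ≈⟨ +-congʳ (+-comm x y) ⟩
    (y + x) - (y + z)  ≈⟨ [w+x]-[w+y]≈x-y y x z ⟩
    x - z              ∎

  xy-uv≈[x-u]y+u[y-v] : ∀ x y u v → x * y - u * v ≈ (x - u) * y + u * (y - v)
  xy-uv≈[x-u]y+u[y-v] x y u v = begin
    x * y - u * v                        ≈⟨ [x-y]+[y-z]≈x-z (x * y) (u * y) (u * v) ⟨
    (x * y - u * y) + (u * y - u * v)    ≈⟨ +-cong ([y-z]x≈yx-zx y x u) (x[y-z]≈xy-xz u y v) ⟨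
    (x - u) * y + u * (y - v)            ∎

  -x+y≈0⇒y≈x : ∀ {x y} → - x + y ≈ 0# → y ≈ x
  -x+y≈0⇒y≈x {x} {y} eq = x∙y⁻¹≈ε⇒x≈y y x (≈-trans (+-comm y (- x)) eq)

  x≉0∧y≉0⇒xy≉0 : ∀ {x y} → ¬ x ≈ 0# → ¬ y ≈ 0# → ¬ x * y ≈ 0#
  x≉0∧y≉0⇒xy≉0 {x} {y} x≉0 y≉0 xy≈0 with inverse x x≉0
  ... | x⁻¹ , xx⁻¹≈1 = y≉0 (begin
    y              ≈⟨ *-identityˡ y ⟨
    1# * y         ≈⟨ *-congʳ xx⁻¹≈1 ⟨
    (x * x⁻¹) * y  ≈⟨ *-congʳ (*-comm x x⁻¹) ⟩
    (x⁻¹ * x) * y  ≈⟨ *-assoc x⁻¹ x y ⟩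
    x⁻¹ * (x * y)  ≈⟨ *-congˡ xy≈0 ⟩
    x⁻¹ * 0#       ≈⟨ zeroʳ x⁻¹ ⟩
    0#             ∎)

  -- Affine functions and finite differences on the cube

  bit : Bool → Carrier
  bit true  = 1#
  bit false = 0#

  bit-injective : ∀ {b b′} → bit b ≈ bit b′ → b ≡ b′
  bit-injective {true}  {true}  _ = refl
  bit-injective {true}  {false} 1≈0 = ⊥-elim (0≉1 (≈-sym 1≈0))
  bit-injective {false} {true}  0≈1 = ⊥-elim (0≉1 0≈1)
  bit-injective {false} {false} _ = refl

  embed-bit : ∀ {n} (v : Vec Bool n) i → embed F v i ≡ bit (lookup v i)
  embed-bit v i with lookup v i
  ... | true  = refl
  ... | false = refl

  Σᶠ-cong : ∀ {n} {f g : Fin n → Carrier} → (∀ i → f i ≈ g i) → Σᶠ F f ≈ Σᶠ F g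
  Σᶠ-cong {zero}  f≈g = ≈-refl
  Σᶠ-cong {suc n} f≈g = +-cong (f≈g zero) (Σᶠ-cong (f≈g ∘ suc))

  ⟨_,_⟩ : ∀ {n} → (Fin n → Carrier) → Vec Bool n → Carrier
  ⟨ w , v ⟩ = Σᶠ F (λ i → w i * bit (lookup v i))

  ⟨⟩-[]≔true : ∀ {n} (w : Fin n → Carrier) (v : Vec Bool n) x →
               ⟨ w , v [ x ]≔ true ⟩ ≈ ⟨ w , v [ x ]≔ false ⟩ + w x
  ⟨⟩-[]≔true w (_ ∷ v) zero = begin
    w zero * 1# + S             ≈⟨ +-congʳ (*-identityʳ (w zero)) ⟩
    w zero + S                  ≈⟨ +-comm (w zero) S ⟩
    S + w zero                  ≈⟨ +-congʳ (+-identityˡ S) ⟨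
    (0# + S) + w zero           ≈⟨ +-congʳ (+-congʳ (zeroʳ (w zero))) ⟨
    (w zero * 0# + S) + w zero  ∎
    where S = ⟨ w ∘ suc , v ⟩
  ⟨⟩-[]≔true w (y ∷ v) (suc x) = begin
    w zero * bit y + ⟨ w ∘ suc , v [ x ]≔ true ⟩                 ≈⟨ +-congˡ (⟨⟩-[]≔true (w ∘ suc) v x) ⟩
    w zero * bit y + (⟨ w ∘ suc , v [ x ]≔ false ⟩ + w (suc x))  ≈⟨ +-assoc _ _ _ ⟨
    (w zero * bit y + ⟨ w ∘ suc , v [ x ]≔ false ⟩) + w (suc x)  ∎

  value : ∀ {n} → Hyperplane F n → Vec Bool n → Carrier
  value H v = evalH F H (embed F v)

  value≈const+⟨coeff⟩ : ∀ {n} (H : Hyperplane F n) v →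
                        value H v ≈ Hyperplane.const H + ⟨ Hyperplane.coeff H , v ⟩
  value≈const+⟨coeff⟩ H v =
    +-congˡ (Σᶠ-cong (λ i → *-congˡ (reflexive (embed-bit v i))))

  record Affine {n} (g : Vec Bool n → Carrier) : Set (c ⊔ ℓ) where
    field
      slope : Fin n → Carrier
      shift : ∀ x v → g (v [ x ]≔ true) ≈ g (v [ x ]≔ false) + slope x

  value-affine : ∀ {n} (H : Hyperplane F n) → Affine (value H)
  value-affine H = record { slope = coeff ; shift = λ x v → begin
    value H (v [ x ]≔ true)                         ≈⟨ value≈const+⟨coeff⟩ H (v [ x ]≔ true) ⟩
    const + ⟨ coeff , v [ x ]≔ true ⟩               ≈⟨ +-congˡ (⟨⟩-[]≔true coeff v x) ⟩
    const + (⟨ coeff , v [ x ]≔ false ⟩ + coeff x)  ≈⟨ +-assoc _ _ _ ⟨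
    (const + ⟨ coeff , v [ x ]≔ false ⟩) + coeff x  ≈⟨ +-congʳ (value≈const+⟨coeff⟩ H (v [ x ]≔ false)) ⟨
    value H (v [ x ]≔ false) + coeff x              ∎ }
    where open Hyperplane H

  affine-∘[]≔ : ∀ {n} {g : Vec Bool n → Carrier} → Affine g → ∀ i b → Affine (λ v → g (v [ i ]≔ b))
  affine-∘[]≔ {g = g} g-affine i b = record { slope = slope′ ; shift = shift′ }
    where
    open Affine g-affine
    slope′ : Fin _ → Carrier
    slope′ x with x Fin.≟ i
    ... | yes _ = 0#
    ... | no  _ = slope x
    shift′ : ∀ x v → g ((v [ x ]≔ true) [ i ]≔ b) ≈ g ((v [ x ]≔ false) [ i ]≔ b) + slope′ x
    shift′ x v with x Fin.≟ i
    ... | yes refl = begin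
      g ((v [ x ]≔ true) [ x ]≔ b)        ≡⟨ cong g ([]≔-idempotent v x) ⟩
      g (v [ x ]≔ b)                      ≡⟨ cong g ([]≔-idempotent v x) ⟨
      g ((v [ x ]≔ false) [ x ]≔ b)       ≈⟨ +-identityʳ _ ⟨
      g ((v [ x ]≔ false) [ x ]≔ b) + 0#  ∎
    ... | no x≢i = begin
      g ((v [ x ]≔ true) [ i ]≔ b)              ≡⟨ cong g ([]≔-commutes v x i x≢i) ⟩
      g ((v [ i ]≔ b) [ x ]≔ true)              ≈⟨ shift x (v [ i ]≔ b) ⟩
      g ((v [ i ]≔ b) [ x ]≔ false) + slope x   ≡⟨ cong (λ w → g w + slope x) ([]≔-commutes v x i x≢i) ⟨
      g ((v [ x ]≔ false) [ i ]≔ b) + slope x   ∎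

  affine-∘assign : ∀ {n} {g : Vec Bool n → Carrier} → Affine g → ∀ p b → Affine (g ∘ assign p b)
  affine-∘assign g-affine (i , j) b = affine-∘[]≔ (affine-∘[]≔ g-affine j (not b)) i b

  Δ : ∀ {n} → Pair n → (Vec Bool n → Carrier) → Vec Bool n → Carrier
  Δ p f v = f (assign p false v) - f (assign p true v)

  Δ-affine : ∀ {n} {g : Vec Bool n → Carrier} → Affine g → ∀ p → ∃ λ k → ∀ v → Δ p g v ≈ k
  Δ-affine {g = g} g-affine (i , j) = slope j - Affine.slope gⱼ i , λ v → begin
    g ((v [ i ]≔ false) [ j ]≔ true) - g ((v [ i ]≔ true) [ j ]≔ false)
      ≈⟨ +-cong (shift j (v [ i ]≔ false)) (-‿cong (Affine.shift gⱼ i v)) ⟩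
    (w v + slope j) - (w v + Affine.slope gⱼ i)  ≈⟨ [w+x]-[w+y]≈x-y (w v) _ _ ⟩
    slope j - Affine.slope gⱼ i                  ∎
    where
    open Affine g-affine
    gⱼ = affine-∘[]≔ g-affine j false
    w = λ v → g ((v [ i ]≔ false) [ j ]≔ false)

  data Deg≤ {n} : ℕ → (Vec Bool n → Carrier) → Set (c ⊔ ℓ) where
    const : ∀ {m} k → Deg≤ m (λ _ → k)
    plus  : ∀ {m f g} → Deg≤ m f → Deg≤ m g → Deg≤ m (λ v → f v + g v)
    scale : ∀ {m f} k → Deg≤ m f → Deg≤ m (λ v → k * f v)
    times : ∀ {m f g} → Deg≤ m f → Affine g → Deg≤ (suc m) (λ v → f v * g v)
    resp  : ∀ {m f g} → (∀ v → f v ≈ g v) → Deg≤ m f → Deg≤ m g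

  Deg≤-∘ : ∀ {n m} {f : Vec Bool n → Carrier} (ρ : Vec Bool n → Vec Bool n) →
           (∀ {g} → Affine g → Affine (g ∘ ρ)) → Deg≤ m f → Deg≤ m (f ∘ ρ)
  Deg≤-∘ ρ ρ-affine (const k)     = const k
  Deg≤-∘ ρ ρ-affine (plus d e)    = plus (Deg≤-∘ ρ ρ-affine d) (Deg≤-∘ ρ ρ-affine e)
  Deg≤-∘ ρ ρ-affine (scale k d)   = scale k (Deg≤-∘ ρ ρ-affine d)
  Deg≤-∘ ρ ρ-affine (times d a)   = times (Deg≤-∘ ρ ρ-affine d) (ρ-affine a)
  Deg≤-∘ ρ ρ-affine (resp f≈g d)  = resp (f≈g ∘ ρ) (Deg≤-∘ ρ ρ-affine d)

  Δ-Deg≤0 : ∀ {n} {f : Vec Bool n → Carrier} p → Deg≤ 0 f → ∀ v → Δ p f v ≈ 0#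
  Δ-Deg≤0 p (const k) v = -‿inverseʳ k
  Δ-Deg≤0 p (plus {f = f} {g} d e) v = begin
    Δ p (λ v → f v + g v) v  ≈⟨ [x+y]-[u+v]≈[x-u]+[y-v] _ _ _ _ ⟩
    Δ p f v + Δ p g v        ≈⟨ +-cong (Δ-Deg≤0 p d v) (Δ-Deg≤0 p e v) ⟩
    0# + 0#                  ≈⟨ +-identityʳ 0# ⟩
    0#                       ∎
  Δ-Deg≤0 p (scale {f = f} k d) v = begin
    Δ p (λ v → k * f v) v    ≈⟨ x[y-z]≈xy-xz k _ _ ⟨
    k * Δ p f v              ≈⟨ *-congˡ (Δ-Deg≤0 p d v) ⟩
    k * 0#                   ≈⟨ zeroʳ k ⟩
    0#                       ∎
  Δ-Deg≤0 p (resp f≈g d) v =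
    ≈-trans (+-cong (≈-sym (f≈g _)) (-‿cong (≈-sym (f≈g _)))) (Δ-Deg≤0 p d v)

  mutual
    Δ-Deg≤ : ∀ {n m} {f : Vec Bool n → Carrier} p → Deg≤ (suc m) f → Deg≤ m (Δ p f)
    Δ-Deg≤ p (const k)    = resp (λ _ → ≈-sym (-‿inverseʳ k)) (const 0#)
    Δ-Deg≤ p (plus d e)   =
      resp (λ _ → ≈-sym ([x+y]-[u+v]≈[x-u]+[y-v] _ _ _ _)) (plus (Δ-Deg≤ p d) (Δ-Deg≤ p e))
    Δ-Deg≤ p (scale k d)  = resp (λ _ → x[y-z]≈xy-xz k _ _) (scale k (Δ-Deg≤ p d))
    Δ-Deg≤ p (resp f≈g d) = resp (λ _ → +-cong (f≈g _) (-‿cong (f≈g _))) (Δ-Deg≤ p d)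
    Δ-Deg≤ p (times {f = f} {g} d g-affine) =
      resp product-rule (plus (Δ-times p d g-affine) (scale k (Deg≤-∘ τ (λ a → affine-∘assign a p true) d)))
      where
      σ = assign p false
      τ = assign p true
      k = proj₁ (Δ-affine g-affine p)
      product-rule : ∀ v → Δ p f v * g (σ v) + k * f (τ v) ≈ Δ p (λ v → f v * g v) v
      product-rule v = begin
        Δ p f v * g (σ v) + k * f (τ v)          ≈⟨ +-congˡ (*-comm k (f (τ v))) ⟩
        Δ p f v * g (σ v) + f (τ v) * k          ≈⟨ +-congˡ (*-congˡ (proj₂ (Δ-affine g-affine p) v)) ⟨
        Δ p f v * g (σ v) + f (τ v) * Δ p g v    ≈⟨ xy-uv≈[x-u]y+u[y-v] _ _ _ _ ⟨
        f (σ v) * g (σ v) - f (τ v) * g (τ v)    ∎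

    Δ-times : ∀ {n m} {f g : Vec Bool n → Carrier} p → Deg≤ m f → Affine g →
              Deg≤ m (λ v → Δ p f v * g (assign p false v))
    Δ-times {m = zero}  p d g-affine =
      resp (λ v → ≈-sym (≈-trans (*-congʳ (Δ-Deg≤0 p d v)) (zeroˡ _))) (const 0#)
    Δ-times {m = suc m} p d g-affine = times (Δ-Deg≤ p d) (affine-∘assign g-affine p false)

  -- The lower bound

  Δ* : ∀ {n} → List (Pair n) → (Vec Bool n → Carrier) → Vec Bool n → Carrier
  Δ* []      f = f
  Δ* (p ∷ P) f = Δ* P (Δ p f)

  Δ*-vanishing : ∀ {n} {f : Vec Bool n → Carrier} P → (∀ v → f v ≈ 0#) → ∀ v → Δ* P f v ≈ 0#
  Δ*-vanishing []      f≈0 = f≈0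
  Δ*-vanishing (p ∷ P) f≈0 = Δ*-vanishing P (λ v → x≈y⇒x∙y⁻¹≈ε (≈-trans (f≈0 _) (≈-sym (f≈0 _))))

  Δ*-Deg≤ : ∀ {n m} {f : Vec Bool n → Carrier} P → Deg≤ m f → m ℕ.< length P → ∀ v → Δ* P f v ≈ 0#
  Δ*-Deg≤ {m = zero}  (p ∷ P) d _         = Δ*-vanishing P (Δ-Deg≤0 p d)
  Δ*-Deg≤ {m = suc m} (p ∷ P) d (s≤s m<P) = Δ*-Deg≤ P (Δ-Deg≤ p d) m<P

  -- τ fixes every point reachable through the remaining pairs, so Δ p f again vanishes off a,
  -- and Δ p f a = f (σ a) - f a with f (σ a) = 0.
  Δ*-nonvanishing : ∀ {n} {a : Vec Bool n} {P} {f : Vec Bool n → Carrier} → Matching a P →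
                    (∀ v → Reachable a P v → v ≢ a → f v ≈ 0#) → ¬ f a ≈ 0# → ¬ Δ* P f a ≈ 0#
  Δ*-nonvanishing [] _ fa≉0 = fa≉0
  Δ*-nonvanishing {a = a} {f = f} (cons {i} {j} ai aj avoidsᵢ avoidsⱼ m) f≈0 fa≉0 =
    Δ*-nonvanishing m Δf≈0 Δfa≉0
    where
    p = (i , j)
    σ = assign p false
    τ = assign p true

    σv≢a : ∀ v → σ v ≢ a
    σv≢a v σv≡a with trans (sym (lookup-assign-fst v false (lookup-true-false⇒≢ a ai aj)))
                           (trans (cong (λ w → lookup w i) σv≡a) ai)
    ... | ()

    Δf≈0 : ∀ v → Reachable a _ v → v ≢ a → Δ p f v ≈ 0#
    Δf≈0 v r v≢a = begin
      f (σ v) - f (τ v)  ≈⟨ +-cong (f≈0 (σ v) (transfer r) (σv≢a v)) (-‿cong (reflexive (cong f τv≡v))) ⟩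
      0# - f v           ≈⟨ +-congˡ (-‿cong (f≈0 v (skip r) v≢a)) ⟩
      0# - 0#            ≈⟨ -‿inverseʳ 0# ⟩
      0#                 ∎
      where τv≡v = assign-self v (trans (lookup-reachable avoidsᵢ r) ai) (trans (lookup-reachable avoidsⱼ r) aj)

    Δfa≉0 : ¬ Δ p f a ≈ 0#
    Δfa≉0 Δfa≈0 = fa≉0 (begin
      f a      ≡⟨ cong f (assign-self a ai aj) ⟨
      f (τ a)  ≈⟨ x∙y⁻¹≈ε⇒x≈y _ _ Δfa≈0 ⟨
      f (σ a)  ≈⟨ f≈0 (σ a) (transfer base) (σv≢a a) ⟩
      0#       ∎)

  product : ∀ {n} → List (Hyperplane F n) → Vec Bool n → Carrier
  product []       v = 1#
  product (H ∷ hs) v = product hs v * value H v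

  product-Deg≤ : ∀ {n} (hs : List (Hyperplane F n)) → Deg≤ (length hs) (product hs)
  product-Deg≤ []       = const 1#
  product-Deg≤ (H ∷ hs) = times (product-Deg≤ hs) (value-affine H)

  product≈0 : ∀ {n} (hs : List (Hyperplane F n)) {v} → Any (_∈H_ F (embed F v)) hs → product hs v ≈ 0#
  product≈0 (H ∷ hs) (here v∈H)   = ≈-trans (*-congˡ v∈H) (zeroʳ _)
  product≈0 (H ∷ hs) (there v∈hs) = ≈-trans (*-congʳ (product≈0 hs v∈hs)) (zeroˡ _)

  product≉0 : ∀ {n} (hs : List (Hyperplane F n)) {v} → ¬ Any (_∈H_ F (embed F v)) hs → ¬ product hs v ≈ 0#
  product≉0 []       _      1≈0 = 0≉1 (≈-sym 1≈0)
  product≉0 (H ∷ hs) v∉hs =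
    x≉0∧y≉0⇒xy≉0 (product≉0 hs (v∉hs ∘ there)) (v∉hs ∘ here)

  matching≤cover : ∀ {n k} {a : Vec Bool n} {P} → InSlice k a → Matching a P →
                   ∀ hs → ExactCover F k (λ v → ¬ v ≡ a) hs → length P ≤ length hs
  matching≤cover {a = a} {P} a∈slice m hs cover = ≮⇒≥ λ hs<P →
    Δ*-nonvanishing m vanishes-off-a (product≉0 hs a∉hs) (Δ*-Deg≤ P (product-Deg≤ hs) hs<P a)
    where
    vanishes-off-a : ∀ v → Reachable a P v → v ≢ a → product hs v ≈ 0#
    vanishes-off-a v r v≢a =
      product≈0 hs (Equivalence.from (cover v (trans (weight-reachable m r) a∈slice)) v≢a)
    a∉hs : ¬ Any (_∈H_ F (embed F a)) hs
    a∉hs a∈hs = Equivalence.to (cover a a∈slice) a∈hs refl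

  -- The upper bound

  unit : ∀ {n} → Fin n → Fin n → Carrier
  unit zero    zero    = 1#
  unit zero    (suc _) = 0#
  unit (suc _) zero    = 0#
  unit (suc i) (suc j) = unit i j

  unit-diagonal : ∀ {n} (i : Fin n) → unit i i ≡ 1#
  unit-diagonal zero    = refl
  unit-diagonal (suc i) = unit-diagonal i

  Σᶠ-0* : ∀ {n} (x : Fin n → Carrier) → Σᶠ F (λ j → 0# * x j) ≈ 0#
  Σᶠ-0* {zero}  x = ≈-refl
  Σᶠ-0* {suc n} x = ≈-trans (+-cong (zeroˡ (x zero)) (Σᶠ-0* (x ∘ suc))) (+-identityʳ 0#)

  Σᶠ-unit : ∀ {n} (i : Fin n) (x : Fin n → Carrier) → Σᶠ F (λ j → unit i j * x j) ≈ x i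
  Σᶠ-unit zero    x = ≈-trans (+-cong (*-identityˡ (x zero)) (Σᶠ-0* (x ∘ suc))) (+-identityʳ (x zero))
  Σᶠ-unit (suc i) x = ≈-trans (+-cong (zeroˡ (x zero)) (Σᶠ-unit i (x ∘ suc))) (+-identityˡ (x (suc i)))

  coordinate : ∀ {n} → Fin n → Carrier → Hyperplane F n
  coordinate i c = record
    { const   = - c
    ; coeff   = unit i
    ; nonzero = i , λ uᵢᵢ≈0 → 0≉1 (≈-sym (≈-trans (reflexive (sym (unit-diagonal i))) uᵢᵢ≈0))
    }

  ∈-coordinate⁺ : ∀ {n} (v : Vec Bool n) {i b} → lookup v i ≡ b → _∈H_ F (embed F v) (coordinate i (bit b))
  ∈-coordinate⁺ v {i} {b} vᵢ≡b = begin
    - bit b + Σᶠ F (λ j → unit i j * embed F v j)  ≈⟨ +-congˡ (Σᶠ-unit i (embed F v)) ⟩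
    - bit b + embed F v i                          ≡⟨ cong (λ z → - bit b + z) (trans (embed-bit v i) (cong bit vᵢ≡b)) ⟩
    - bit b + bit b                                ≈⟨ -‿inverseˡ (bit b) ⟩
    0#                                             ∎

  ∈-coordinate⁻ : ∀ {n} (v : Vec Bool n) {i b} → _∈H_ F (embed F v) (coordinate i (bit b)) → lookup v i ≡ b
  ∈-coordinate⁻ v {i} {b} v∈H = bit-injective (-x+y≈0⇒y≈x (begin
    - bit b + bit (lookup v i)                     ≡⟨ cong (λ z → - bit b + z) (embed-bit v i) ⟨
    - bit b + embed F v i                          ≈⟨ +-congˡ (Σᶠ-unit i (embed F v)) ⟨
    - bit b + Σᶠ F (λ j → unit i j * embed F v j)  ≈⟨ v∈H ⟩
    0#                                             ∎))

  coordinates-cover : ∀ {n k} (a : Vec Bool n) → InSlice k a → ∀ b →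
                      ExactCover F k (λ v → ¬ v ≡ a) (map (λ i → coordinate i (bit (not b))) (positions b a))
  coordinates-cover a a∈slice b v v∈slice = mk⇔ on⇒≢a ≢a⇒on
    where
    on⇒≢a : Any (_∈H_ F (embed F v)) (map (λ i → coordinate i (bit (not b))) (positions b a)) → v ≢ a
    on⇒≢a v∈hs refl with find (Any.map⁻ v∈hs)
    ... | i , i∈ , v∈Hᵢ = not-¬ (∈-positions⁻ a i∈) (∈-coordinate⁻ a v∈Hᵢ)
    ≢a⇒on : v ≢ a → Any (_∈H_ F (embed F v)) (map (λ i → coordinate i (bit (not b))) (positions b a))
    ≢a⇒on v≢a with weight≡∧≢⇒differ v a (trans v∈slice (sym a∈slice)) v≢a b
    ... | i , aᵢ≡b , vᵢ≡¬b = Any.map⁺ (lose (∈-positions⁺ a aᵢ≡b) (∈-coordinate⁺ v vᵢ≡¬b))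

theorem1p3 : ∀ {c ℓ : Level} (F : Field c ℓ) (n k : ℕ) → 1 ≤ k → k ≤ n →
    (a : Vec Bool n) → InSlice k a →
    ECEquals F n k (λ v → ¬ (v ≡ a)) (k ⊓ (n ∸ k))
theorem1p3 F n k _ _ a a∈slice = upper , lower
  where
  lower : ∀ hs → ExactCover F k (λ v → ¬ v ≡ a) hs → k ⊓ (n ∸ k) ≤ length hs
  lower hs cover =
    subst (_≤ length hs) (trans (length-standardMatching a) (cong (λ w → w ⊓ (n ∸ w)) a∈slice))
      (matching≤cover F a∈slice (standardMatching-matching a) hs cover)

  cover-by-coordinates : ∀ b → length (positions b a) ≡ k ⊓ (n ∸ k) →
    Σ (List (Hyperplane F n)) λ hs → length hs ≡ k ⊓ (n ∸ k) × ExactCover F k (λ v → ¬ v ≡ a) hs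
  cover-by-coordinates b len =
    _ , trans (length-map _ (positions b a)) len , coordinates-cover F a a∈slice b

  upper : Σ (List (Hyperplane F n)) λ hs → length hs ≡ k ⊓ (n ∸ k) × ExactCover F k (λ v → ¬ v ≡ a) hs
  upper with ⊓-sel k (n ∸ k)
  ... | inj₁ min≡k   = cover-by-coordinates true
                         (trans (trans (length-positions-true a) a∈slice) (sym min≡k))
  ... | inj₂ min≡n∸k = cover-by-coordinates false
                         (trans (trans (length-positions-false a) (cong (n ∸_) a∈slice)) (sym min≡n∸k))
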